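{- Let $\mathcal{A}=(a_n)_{n\in\mathbb{N}_+}$ be a sequence of positive integers and let $k\geqslant 2$ be an integer. Then \[ \lim_{N\to\infty}\frac{\#\{n\leqslant N:\ p_\mathcal{A}(n,k)\equiv 1 \text{ and } p_\mathcal{A}(n,k-1)\equiv 1 \pmod{2}\}}{N} =\lim_{N\to\infty}\frac{\#\{n\leqslant N:\ p_\mathcal{A}(n,k)\equiv 0 \text{ and } p_\mathcal{A}(n,k-1)\equiv 1 \pmod{2}\}}{N}, \] where $n$ ranges over $\mathbb{N}$.
   Context: $\mathbb{N}=\{0,1,2,\ldots\}$. For $k\in\mathbb{N}_+$ and $n\in\mathbb{N}$, $p_\mathcal{A}(n,k)$ is the number of tuples $(x_1,\ldots,x_k)\in\mathbb{N}^k$ with $a_1x_1+\cdots+a_kx_k=n$, i.e. $\sum_{n\ge0}p_\mathcal{A}(n,k)x^n=\prod_{i=1}^k(1-x^{a_i})^{ -1}$. -}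

module Defs where

open import Data.Nat as ℕ using (ℕ; zero; suc; _+_; _*_; _≟_; _%_)
open import Data.Integer using (+_)
open import Data.Rational using (ℚ; _/_; _-_; ∣_∣; _<_; 0ℚ)
open import Data.List using (List; []; _∷_; [_]; map; concatMap; upTo; filter; length)
open import Data.Vec as Vec using (Vec; lookup; tabulate)
open import Data.Fin using (Fin; toℕ)
open import Data.Product using (_×_; ∃-syntax)
open import Relation.Nullary.Decidable using (_×-dec_)

-- All tuples (x_1,…,x_k) ∈ {0,…,n}^k (as vectors; position i ↔ x_{i+1}).
tuples : (k n : ℕ) → List (Vec ℕ k)
tuples zero    n = [ Vec.[] ]
tuples (suc k) n = concatMap (λ x → map (x Vec.∷_) (tuples k n)) (upTo (suc n))

-- a_1 x_1 + ⋯ + a_k x_k, the sequence 𝒜 = (a_i)_{i ≥ 1} given as a : ℕ → ℕ (a 0 unused).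
wsum : (a : ℕ → ℕ) (k : ℕ) → Vec ℕ k → ℕ
wsum a k xs = Vec.sum (tabulate (λ (i : Fin k) → a (suc (toℕ i)) * lookup xs i))

-- p_𝒜(n,k) = #{ (x_1,…,x_k) ∈ ℕ^k : a_1 x_1 + ⋯ + a_k x_k = n }.
-- Since every a_i ≥ 1, every solution has all x_i ≤ n, so enumerating {0,…,n}^k is exhaustive.
pA : (a : ℕ → ℕ) (n k : ℕ) → ℕ
pA a n k = length (filter (λ xs → wsum a k xs ≟ n) (tuples k n))

count : (a : ℕ → ℕ) (k b N : ℕ) → ℕ
count a k b N =
  length (filter (λ n → (pA a n k % 2 ≟ b) ×-dec (pA a n (k ℕ.∸ 1) % 2 ≟ 1)) (upTo (suc N)))

-- The ratio count/N, indexed by m with N = m + 1 (N ≥ 1).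
ratio : (a : ℕ → ℕ) (k b : ℕ) → ℕ → ℚ
ratio a k b m = (+ count a k b (suc m)) / suc m

-- A rational sequence converges (in ℝ) iff it is Cauchy.
Convergent : (ℕ → ℚ) → Set
Convergent s = ∀ (ε : ℚ) → 0ℚ < ε → ∃[ M ] ∀ m m′ → M ℕ.≤ m → M ℕ.≤ m′ → ∣ s m - s m′ ∣ < ε

DiffTendsToZero : (ℕ → ℚ) → (ℕ → ℚ) → Set
DiffTendsToZero s t = ∀ (ε : ℚ) → 0ℚ < ε → ∃[ M ] ∀ m → M ℕ.≤ m → ∣ s m - t m ∣ < ε

SameLimit : (ℕ → ℚ) → (ℕ → ℚ) → Set
SameLimit s t = Convergent s × Convergent t × DiffTendsToZero s t

{-# OPTIONS --safe #-}
-- Write c = a_k, g n = p(n,k-1) and h n = p(n,k). Splitting off the variable x_k gives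
-- h n = g n + h (n - c), the last term being 0 for n < c. Reducing mod 2 and iterating,
-- h (n + 2cQ) ≡ h n whenever g is eventually Q-periodic mod 2, so by induction every p(·,j)
-- is eventually periodic mod 2. Among the n with g n odd, h n is odd exactly when h (n - c)
-- is even; summing over n < t, the numbers C₁ t and C₀ t of n < t with g n odd and h n odd,
-- resp. even, satisfy C₁ t - C₀ t = #{t - c ≤ m < t : h m odd} ∈ [0, c]. As C₁ t + C₀ t counts
-- the n < t with g n odd, periodicity makes it a constant times t up to a bounded error, hence
-- so are C₁ and C₀ (with half the constant), and their densities agree.
module Submission where

open import Defs
open import Data.Nat using (ℕ; _≤_; _<_)

open import Data.Nat.Properties
open import Algebra.Properties.CommutativeSemigroup +-commutativeSemigroup
  using (interchange; x∙yz≈yx∙z; xy∙z≈xz∙y)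
import Algebra.Properties.CommutativeSemigroup *-commutativeSemigroup as *-CS
open import Data.Bool.Base using (Bool; true; false)
import Data.Integer.Base as ℤ
import Data.Integer.Properties as ℤ
open import Data.List.Base using (List; []; _∷_; _++_; map; concatMap; filter; length; upTo; [_])
open import Data.List.Properties using (upTo-∷ʳ)
open import Data.Nat using (zero; suc; _+_; _*_; _∸_; _%_; ∣_-_∣; z≤n; s≤s; s≤s⁻¹; _≤?_; _<?_; _≟_; >-nonZero)
open import Data.Nat.Coprimality using (Coprime)
open import Data.Nat.DivMod using (%-distribˡ-+; %-remove-+ˡ; m*n%n≡0; m%n<n)
open import Data.Nat.Divisibility using (m%n≡0⇒n∣m)
open import Data.Nat.Induction using (<-rec)
open import Data.Nat.Tactic.RingSolver using (solve-∀)
open import Data.Product.Base using (_×_; _,_; ∃-syntax)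
open import Data.Rational.Base as ℚ using (mkℚ; _/_; 0ℚ; toℚᵘ)
import Data.Rational.Properties as ℚ
import Data.Rational.Unnormalised.Base as ℚᵘ
import Data.Rational.Unnormalised.Properties as ℚᵘ
open import Data.Sum.Base using (_⊎_; inj₁; inj₂)
import Data.Vec.Base as Vec
open import Function.Bundles using (mk⇔)
open import Relation.Nullary using (yes; no; does)
open import Relation.Nullary.Decidable using (_×-dec_; dec-true; dec-false; does-⇔)
open import Relation.Unary using (Decidable)
open import Relation.Binary.PropositionalEquality hiding ([_])

iverson : Bool → ℕ
iverson true  = 1
iverson false = 0

iverson≤1 : ∀ b → iverson b ≤ 1
iverson≤1 true  = ≤-refl
iverson≤1 false = z≤n

sumBy : {A : Set} → (A → ℕ) → List A → ℕ
sumBy f []       = 0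
sumBy f (x ∷ xs) = f x + sumBy f xs

length-filter≡sumBy : {A : Set} {P : A → Set} (P? : Decidable P) (xs : List A) →
                      length (filter P? xs) ≡ sumBy (λ x → iverson (does (P? x))) xs
length-filter≡sumBy P? []       = refl
length-filter≡sumBy P? (x ∷ xs) with does (P? x)
... | true  = cong suc (length-filter≡sumBy P? xs)
... | false = length-filter≡sumBy P? xs

sumBy-++ : {A : Set} (f : A → ℕ) (xs ys : List A) → sumBy f (xs ++ ys) ≡ sumBy f xs + sumBy f ys
sumBy-++ f []       ys = refl
sumBy-++ f (x ∷ xs) ys = trans (cong (f x +_) (sumBy-++ f xs ys)) (sym (+-assoc (f x) _ _))

sumBy-concatMap : {A B : Set} (f : B → ℕ) (g : A → List B) (xs : List A) →
                  sumBy f (concatMap g xs) ≡ sumBy (λ x → sumBy f (g x)) xs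
sumBy-concatMap f g []       = refl
sumBy-concatMap f g (x ∷ xs) =
  trans (sumBy-++ f (g x) (concatMap g xs)) (cong (sumBy f (g x) +_) (sumBy-concatMap f g xs))

sumBy-map : {A B : Set} (f : B → ℕ) (g : A → B) (xs : List A) → sumBy f (map g xs) ≡ sumBy (λ x → f (g x)) xs
sumBy-map f g []       = refl
sumBy-map f g (x ∷ xs) = cong (f (g x) +_) (sumBy-map f g xs)

sumBy-cong : {A : Set} {f g : A → ℕ} → (∀ x → f x ≡ g x) → (xs : List A) → sumBy f xs ≡ sumBy g xs
sumBy-cong f≗g []       = refl
sumBy-cong f≗g (x ∷ xs) = cong₂ _+_ (f≗g x) (sumBy-cong f≗g xs)

*-distribˡ-sumBy : {A : Set} (c : ℕ) (f : A → ℕ) (xs : List A) → c * sumBy f xs ≡ sumBy (λ x → c * f x) xs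
*-distribˡ-sumBy c f []       = *-zeroʳ c
*-distribˡ-sumBy c f (x ∷ xs) = trans (*-distribˡ-+ c (f x) _) (cong (c * f x +_) (*-distribˡ-sumBy c f xs))

∑< : ℕ → (ℕ → ℕ) → ℕ
∑< zero    f = 0
∑< (suc t) f = ∑< t f + f t

infix 5 ∑<
syntax ∑< t (λ i → e) = ∑[ i < t ] e

sumBy-upTo : (f : ℕ → ℕ) (t : ℕ) → sumBy f (upTo t) ≡ ∑[ i < t ] f i
sumBy-upTo f zero    = refl
sumBy-upTo f (suc t) = begin
  sumBy f (upTo (suc t))       ≡⟨ cong (sumBy f) (sym (upTo-∷ʳ t)) ⟩
  sumBy f (upTo t ++ [ t ])    ≡⟨ sumBy-++ f (upTo t) [ t ] ⟩
  sumBy f (upTo t) + (f t + 0) ≡⟨ cong₂ _+_ (sumBy-upTo f t) (+-identityʳ (f t)) ⟩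
  (∑[ i < t ] f i) + f t       ∎
  where open ≡-Reasoning

∑-cong : {f g : ℕ → ℕ} (t : ℕ) → (∀ i → i < t → f i ≡ g i) → ∑[ i < t ] f i ≡ ∑[ i < t ] g i
∑-cong zero    f≗g = refl
∑-cong (suc t) f≗g = cong₂ _+_ (∑-cong t (λ i i<t → f≗g i (m<n⇒m<1+n i<t))) (f≗g t (n<1+n t))

∑-zero : (t : ℕ) → ∑[ i < t ] 0 ≡ 0
∑-zero zero    = refl
∑-zero (suc t) = cong (_+ 0) (∑-zero t)

∑-head : (f : ℕ → ℕ) (t : ℕ) → ∑[ i < suc t ] f i ≡ f 0 + (∑[ i < t ] f (suc i))
∑-head f zero    = +-comm 0 (f 0)
∑-head f (suc t) = trans (cong (_+ f (suc t)) (∑-head f t)) (+-assoc (f 0) _ _)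

∑-+ : (f g : ℕ → ℕ) (t : ℕ) → ∑[ i < t ] (f i + g i) ≡ (∑[ i < t ] f i) + (∑[ i < t ] g i)
∑-+ f g zero    = refl
∑-+ f g (suc t) = trans (cong (_+ (f t + g t)) (∑-+ f g t)) (interchange (∑< t f) (∑< t g) (f t) (g t))

*-distribˡ-∑ : (c : ℕ) (f : ℕ → ℕ) (t : ℕ) → c * (∑[ i < t ] f i) ≡ ∑[ i < t ] c * f i
*-distribˡ-∑ c f zero    = *-zeroʳ c
*-distribˡ-∑ c f (suc t) = trans (*-distribˡ-+ c (∑< t f) (f t)) (cong (_+ c * f t) (*-distribˡ-∑ c f t))

∑-comm : (h : ℕ → ℕ → ℕ) (s t : ℕ) → ∑[ i < t ] ∑[ j < s ] h i j ≡ ∑[ j < s ] ∑[ i < t ] h i j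
∑-comm h s zero    = sym (∑-zero s)
∑-comm h s (suc t) = trans (cong (_+ (∑[ j < s ] h t j)) (∑-comm h s t))
                           (sym (∑-+ (λ j → ∑[ i < t ] h i j) (h t) s))

∑-split : (f : ℕ → ℕ) (s t : ℕ) → ∑[ i < s + t ] f i ≡ (∑[ i < s ] f i) + (∑[ i < t ] f (s + i))
∑-split f s zero    = trans (cong (λ r → ∑< r f) (+-identityʳ s)) (sym (+-identityʳ (∑< s f)))
∑-split f s (suc t) = trans (cong (λ r → ∑< r f) (+-suc s t))
                            (trans (cong (_+ f (s + t)) (∑-split f s t)) (+-assoc (∑< s f) _ _))

∑-≤ : (f : ℕ → ℕ) → (∀ i → f i ≤ 1) → ∀ t → ∑[ i < t ] f i ≤ t
∑-≤ f f≤1 zero    = z≤n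
∑-≤ f f≤1 (suc t) = subst (∑< t f + f t ≤_) (+-comm t 1) (+-mono-≤ (∑-≤ f f≤1 t) (f≤1 t))

-- The recurrence p(n,k) = p(n,k-1) + p(n-a_k,k)

⟦_≤_⟧ : ℕ → ℕ → ℕ
⟦ u ≤ n ⟧ = iverson (does (u ≤? n))

⟦_≡_⟧ : ℕ → ℕ → ℕ
⟦ u ≡ n ⟧ = iverson (does (u ≟ n))

⟦≤⟧-yes : ∀ {u n} → u ≤ n → ⟦ u ≤ n ⟧ ≡ 1
⟦≤⟧-yes {u} {n} u≤n = cong iverson (dec-true (u ≤? n) u≤n)

⟦≤⟧-no : ∀ {u n} → n < u → ⟦ u ≤ n ⟧ ≡ 0
⟦≤⟧-no {u} {n} n<u = cong iverson (dec-false (u ≤? n) (<⇒≱ n<u))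

-- Multiplication by x^u on generating functions.
shift : ℕ → (ℕ → ℕ) → ℕ → ℕ
shift u f n = ⟦ u ≤ n ⟧ * f (n ∸ u)

shift-+ : ∀ u f m → shift u f (u + m) ≡ f m
shift-+ u f m rewrite ⟦≤⟧-yes (m≤m+n u m) | m+n∸m≡n u m = *-identityˡ (f m)

shift-< : ∀ {u n} f → n < u → shift u f n ≡ 0
shift-< {u} {n} f n<u rewrite ⟦≤⟧-no n<u = refl

shift-zero : ∀ f n → shift 0 f n ≡ f n
shift-zero f n = shift-+ 0 f n

shift-cong : ∀ u {f g} n → (∀ m → m ≤ n → f m ≡ g m) → shift u f n ≡ shift u g n
shift-cong u n f≗g = cong (⟦ u ≤ n ⟧ *_) (f≗g (n ∸ u) (m∸n≤m n u))

⟦≤∸⟧ : ∀ {u n} v → u ≤ n → ⟦ v ≤ n ∸ u ⟧ ≡ ⟦ u + v ≤ n ⟧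
⟦≤∸⟧ {u} {n} v u≤n = cong iverson (does-⇔ (mk⇔ to from) (v ≤? n ∸ u) (u + v ≤? n))
  where
  to : v ≤ n ∸ u → u + v ≤ n
  to v≤n∸u = subst (_≤ n) (+-comm v u) (m≤o∸n⇒m+n≤o v u≤n v≤n∸u)
  from : u + v ≤ n → v ≤ n ∸ u
  from u+v≤n = m+n≤o⇒m≤o∸n v (subst (_≤ n) (+-comm u v) u+v≤n)

shift-shift : ∀ u v f n → shift u (shift v f) n ≡ shift (u + v) f n
shift-shift u v f n with u ≤? n
... | yes u≤n = begin
  ⟦ u ≤ n ⟧ * (⟦ v ≤ n ∸ u ⟧ * f (n ∸ u ∸ v))
    ≡⟨ cong (_* (⟦ v ≤ n ∸ u ⟧ * f (n ∸ u ∸ v))) (⟦≤⟧-yes u≤n) ⟩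
  1 * (⟦ v ≤ n ∸ u ⟧ * f (n ∸ u ∸ v))         ≡⟨ *-identityˡ _ ⟩
  ⟦ v ≤ n ∸ u ⟧ * f (n ∸ u ∸ v)               ≡⟨ cong₂ _*_ (⟦≤∸⟧ v u≤n) (cong f (∸-+-assoc n u v)) ⟩
  ⟦ u + v ≤ n ⟧ * f (n ∸ (u + v))             ∎
  where open ≡-Reasoning
... | no u≰n = trans (shift-< (shift v f) n<u) (sym (shift-< f (≤-trans n<u (m≤m+n u v))))
  where
  n<u : n < u
  n<u = ≰⇒> u≰n

shift-∑ : ∀ u (F : ℕ → ℕ → ℕ) t n → shift u (λ m → ∑[ i < t ] F i m) n ≡ ∑[ i < t ] shift u (F i) n
shift-∑ u F t n = *-distribˡ-∑ ⟦ u ≤ n ⟧ (λ i → F i (n ∸ u)) t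

⟦+≡⟧ : ∀ u w n → ⟦ u + w ≡ n ⟧ ≡ shift u (λ m → ⟦ w ≡ m ⟧) n
⟦+≡⟧ u w n with u ≤? n
... | yes u≤n = trans (cong iverson (does-⇔ (mk⇔ to from) (u + w ≟ n) (w ≟ n ∸ u)))
                      (trans (sym (*-identityˡ _)) (cong (_* ⟦ w ≡ n ∸ u ⟧) (sym (⟦≤⟧-yes u≤n))))
  where
  to : u + w ≡ n → w ≡ n ∸ u
  to refl = sym (m+n∸m≡n u w)
  from : w ≡ n ∸ u → u + w ≡ n
  from refl = m+[n∸m]≡n u≤n
... | no u≰n = trans (cong iverson (dec-false (u + w ≟ n) (λ u+w≡n → u≰n (subst (u ≤_) u+w≡n (m≤m+n u w)))))
                     (sym (shift-< (λ m → ⟦ w ≡ m ⟧) (≰⇒> u≰n)))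

AllPositive : (ℕ → ℕ) → Set
AllPositive a = ∀ i → 1 ≤ i → 0 < a i

boundedCount : (ℕ → ℕ) → ℕ → ℕ → ℕ → ℕ
boundedCount a k B n = sumBy (λ xs → ⟦ wsum a k xs ≡ n ⟧) (tuples k B)

pA≡boundedCount : ∀ a n k → pA a n k ≡ boundedCount a k n n
pA≡boundedCount a n k = length-filter≡sumBy (λ xs → wsum a k xs ≟ n) (tuples k n)

-- Multiplication by 1 + x^c + ⋯ + x^(cB) on generating functions.
addPart : ℕ → ℕ → (ℕ → ℕ) → ℕ → ℕ
addPart B c g n = ∑[ x < suc B ] shift (c * x) g n

addPart-cong : ∀ B c {g g′} n → (∀ m → m ≤ n → g m ≡ g′ m) → addPart B c g n ≡ addPart B c g′ n
addPart-cong B c n g≗g′ = ∑-cong (suc B) (λ x _ → shift-cong (c * x) n g≗g′)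

addPart-suc : ∀ B c g n → n < c * suc B → addPart (suc B) c g n ≡ addPart B c g n
addPart-suc B c g n n<c[1+B] = trans (cong (addPart B c g n +_) (shift-< g n<c[1+B])) (+-identityʳ _)

addPart-addPart : ∀ B c d f n →
  addPart B c (addPart B d f) n ≡ ∑[ x < suc B ] ∑[ y < suc B ] shift (c * x + d * y) f n
addPart-addPart B c d f n = ∑-cong (suc B) λ x _ →
  trans (shift-∑ (c * x) (λ y → shift (d * y) f) (suc B) n)
        (∑-cong (suc B) λ y _ → shift-shift (c * x) (d * y) f n)

addPart-comm : ∀ B c d f n → addPart B c (addPart B d f) n ≡ addPart B d (addPart B c f) n
addPart-comm B c d f n = begin
  addPart B c (addPart B d f) n
    ≡⟨ addPart-addPart B c d f n ⟩
  ∑[ x < suc B ] ∑[ y < suc B ] shift (c * x + d * y) f n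
    ≡⟨ ∑-comm (λ x y → shift (c * x + d * y) f n) (suc B) (suc B) ⟩
  ∑[ y < suc B ] ∑[ x < suc B ] shift (c * x + d * y) f n
    ≡⟨ ∑-cong (suc B) (λ y _ → ∑-cong (suc B) λ x _ → cong (λ u → shift u f n) (+-comm (c * x) (d * y))) ⟩
  ∑[ y < suc B ] ∑[ x < suc B ] shift (d * y + c * x) f n
    ≡⟨ sym (addPart-addPart B d c f n) ⟩
  addPart B d (addPart B c f) n ∎
  where open ≡-Reasoning

addPart-unfold : ∀ B c g n → n ≤ B → 1 ≤ c → addPart B c g n ≡ g n + shift c (addPart B c g) n
addPart-unfold B c g n n≤B 1≤c = begin
  addPart B c g n
    ≡⟨ ∑-head (λ x → shift (c * x) g n) B ⟩
  shift (c * 0) g n + (∑[ x < B ] shift (c * suc x) g n)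
    ≡⟨ cong₂ _+_ (trans (cong (λ u → shift u g n) (*-zeroʳ c)) (shift-zero g n)) (sym (+-identityʳ _)) ⟩
  g n + ((∑[ x < B ] shift (c * suc x) g n) + 0)
    ≡⟨ cong (λ z → g n + ((∑[ x < B ] shift (c * suc x) g n) + z)) (sym (shift-< g n<c[1+B])) ⟩
  g n + (∑[ x < suc B ] shift (c * suc x) g n)
    ≡⟨ cong (g n +_) (∑-cong (suc B) λ x _ → trans (cong (λ u → shift u g n) (*-suc c x))
                                                   (sym (shift-shift c (c * x) g n))) ⟩
  g n + (∑[ x < suc B ] shift c (shift (c * x) g) n)
    ≡⟨ cong (g n +_) (sym (shift-∑ c (λ x → shift (c * x) g) (suc B) n)) ⟩
  g n + shift c (addPart B c g) n ∎
  where
  open ≡-Reasoning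
  n<c[1+B] : n < c * suc B
  n<c[1+B] = ≤-trans (s≤s n≤B) (m≤n*m (suc B) c {{>-nonZero 1≤c}})

boundedCount-first : ∀ a k B n → boundedCount a (suc k) B n ≡ addPart B (a 1) (boundedCount (λ i → a (suc i)) k B) n
boundedCount-first a k B n = begin
  boundedCount a (suc k) B n
    ≡⟨ sumBy-concatMap _ (λ x → map (x Vec.∷_) (tuples k B)) (upTo (suc B)) ⟩
  sumBy (λ x → sumBy (λ xs → ⟦ wsum a (suc k) xs ≡ n ⟧) (map (x Vec.∷_) (tuples k B))) (upTo (suc B))
    ≡⟨ sumBy-cong (λ x → sumBy-map _ (x Vec.∷_) (tuples k B)) (upTo (suc B)) ⟩
  sumBy (λ x → sumBy (λ xs → ⟦ a 1 * x + wsum a′ k xs ≡ n ⟧) (tuples k B)) (upTo (suc B))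
    ≡⟨ sumBy-cong (λ x → trans (sumBy-cong (λ xs → ⟦+≡⟧ (a 1 * x) (wsum a′ k xs) n) (tuples k B))
                               (sym (*-distribˡ-sumBy ⟦ a 1 * x ≤ n ⟧ _ (tuples k B)))) (upTo (suc B)) ⟩
  sumBy (λ x → shift (a 1 * x) (boundedCount a′ k B) n) (upTo (suc B))
    ≡⟨ sumBy-upTo _ (suc B) ⟩
  addPart B (a 1) (boundedCount a′ k B) n ∎
  where
  open ≡-Reasoning
  a′ : ℕ → ℕ
  a′ i = a (suc i)

boundedCount-last : ∀ k a B n → boundedCount a (suc k) B n ≡ addPart B (a (suc k)) (boundedCount a k B) n
boundedCount-last zero    a B n = boundedCount-first a zero B n
boundedCount-last (suc k) a B n = begin
  boundedCount a (suc (suc k)) B n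
    ≡⟨ boundedCount-first a (suc k) B n ⟩
  addPart B (a 1) (boundedCount a′ (suc k) B) n
    ≡⟨ addPart-cong B (a 1) n (λ m _ → boundedCount-last k a′ B m) ⟩
  addPart B (a 1) (addPart B (a (2 + k)) (boundedCount a′ k B)) n
    ≡⟨ addPart-comm B (a 1) (a (2 + k)) (boundedCount a′ k B) n ⟩
  addPart B (a (2 + k)) (addPart B (a 1) (boundedCount a′ k B)) n
    ≡⟨ addPart-cong B (a (2 + k)) n (λ m _ → sym (boundedCount-first a k B m)) ⟩
  addPart B (a (2 + k)) (boundedCount a (suc k) B) n ∎
  where
  open ≡-Reasoning
  a′ : ℕ → ℕ
  a′ i = a (suc i)

boundedCount-bound-suc : ∀ k {a} → AllPositive a → ∀ B n → n ≤ B → boundedCount a k B n ≡ boundedCount a k (suc B) n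
boundedCount-bound-suc zero    pos B n n≤B = refl
boundedCount-bound-suc (suc k) {a} pos B n n≤B = begin
  boundedCount a (suc k) B n
    ≡⟨ boundedCount-first a k B n ⟩
  addPart B (a 1) (boundedCount a′ k B) n
    ≡⟨ addPart-cong B (a 1) n (λ m m≤n → boundedCount-bound-suc k pos′ B m (≤-trans m≤n n≤B)) ⟩
  addPart B (a 1) (boundedCount a′ k (suc B)) n
    ≡⟨ sym (addPart-suc B (a 1) (boundedCount a′ k (suc B)) n n<a₁[1+B]) ⟩
  addPart (suc B) (a 1) (boundedCount a′ k (suc B)) n
    ≡⟨ sym (boundedCount-first a k (suc B) n) ⟩
  boundedCount a (suc k) (suc B) n ∎
  where
  open ≡-Reasoning
  a′ : ℕ → ℕ
  a′ i = a (suc i)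
  pos′ : AllPositive a′
  pos′ i _ = pos (suc i) (s≤s z≤n)
  n<a₁[1+B] : n < a 1 * suc B
  n<a₁[1+B] = ≤-trans (s≤s n≤B) (m≤n*m (suc B) (a 1) {{>-nonZero (pos 1 ≤-refl)}})

boundedCount-bound-irrelevant : ∀ k {a} → AllPositive a → ∀ B n → n ≤ B → boundedCount a k B n ≡ boundedCount a k n n
boundedCount-bound-irrelevant k {a} pos B n n≤B with m≤n⇒∃[o]m+o≡n n≤B
... | d , refl = go d
  where
  go : ∀ d → boundedCount a k (n + d) n ≡ boundedCount a k n n
  go zero    = cong (λ b → boundedCount a k b n) (+-identityʳ n)
  go (suc d) = trans (cong (λ b → boundedCount a k b n) (+-suc n d))
                     (trans (sym (boundedCount-bound-suc k pos (n + d) n (m≤m+n n d))) (go d))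

pA-rec : ∀ {a} → AllPositive a → ∀ j n →
         pA a n (suc j) ≡ pA a n j + shift (a (suc j)) (λ m → pA a m (suc j)) n
pA-rec {a} pos j n = begin
  pA a n (suc j)
    ≡⟨ pA≡boundedCount a n (suc j) ⟩
  boundedCount a (suc j) n n
    ≡⟨ boundedCount-last j a n n ⟩
  addPart n c (boundedCount a j n) n
    ≡⟨ addPart-unfold n c (boundedCount a j n) n ≤-refl (pos (suc j) (s≤s z≤n)) ⟩
  boundedCount a j n n + shift c (addPart n c (boundedCount a j n)) n
    ≡⟨ cong₂ _+_ (sym (pA≡boundedCount a n j)) (shift-cong c n λ m m≤n →
         trans (sym (boundedCount-last j a n m))
               (trans (boundedCount-bound-irrelevant (suc j) pos n m m≤n) (sym (pA≡boundedCount a m (suc j))))) ⟩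
  pA a n j + shift c (λ m → pA a m (suc j)) n ∎
  where
  open ≡-Reasoning
  c : ℕ
  c = a (suc j)

-- Eventual periodicity mod 2

[m+[n+o]]%2≡o%2 : ∀ A A′ x → A % 2 ≡ A′ % 2 → (A + (A′ + x)) % 2 ≡ x % 2
[m+[n+o]]%2≡o%2 A A′ x A≡A′ =
  trans (cong (_% 2) (sym (+-assoc A A′ x))) (%-remove-+ˡ x (m%n≡0⇒n∣m (A + A′) 2 A+A′≡0))
  where
  A+A′≡0 : (A + A′) % 2 ≡ 0
  A+A′≡0 = begin
    (A + A′) % 2               ≡⟨ %-distribˡ-+ A A′ 2 ⟩
    (A % 2 + A′ % 2) % 2       ≡⟨ cong (λ r → (r + A′ % 2) % 2) A≡A′ ⟩
    (A′ % 2 + A′ % 2) % 2      ≡⟨ cong (_% 2) (r+r≡r*2 (A′ % 2)) ⟩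
    (A′ % 2 * 2) % 2           ≡⟨ m*n%n≡0 (A′ % 2) 2 ⟩
    0                          ∎
    where
    open ≡-Reasoning
    r+r≡r*2 : ∀ r → r + r ≡ r * 2
    r+r≡r*2 = solve-∀

∑-%2-cong : ∀ (f g : ℕ → ℕ) t → (∀ i → i < t → f i % 2 ≡ g i % 2) → (∑[ i < t ] f i) % 2 ≡ (∑[ i < t ] g i) % 2
∑-%2-cong f g zero    f≡g = refl
∑-%2-cong f g (suc t) f≡g = begin
  ((∑[ i < t ] f i) + f t) % 2                 ≡⟨ %-distribˡ-+ (∑< t f) (f t) 2 ⟩
  ((∑[ i < t ] f i) % 2 + f t % 2) % 2         ≡⟨ cong₂ (λ r s → (r + s) % 2)
                                                   (∑-%2-cong f g t λ i i<t → f≡g i (m<n⇒m<1+n i<t))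
                                                   (f≡g t (n<1+n t)) ⟩
  ((∑[ i < t ] g i) % 2 + g t % 2) % 2         ≡⟨ %-distribˡ-+ (∑< t g) (g t) 2 ⟨
  ((∑[ i < t ] g i) + g t) % 2                 ∎
  where open ≡-Reasoning

record ParityEventuallyPeriodic (f : ℕ → ℕ) : Set where
  field
    period start : ℕ
    1≤period     : 1 ≤ period
    periodic     : ∀ n → start ≤ n → f (n + period) % 2 ≡ f n % 2

  periodic-* : ∀ r n → start ≤ n → f (n + period * r) % 2 ≡ f n % 2
  periodic-* zero    n s≤n = cong (λ m → f m % 2) (trans (cong (n +_) (*-zeroʳ period)) (+-identityʳ n))
  periodic-* (suc r) n s≤n = begin
    f (n + period * suc r) % 2     ≡⟨ cong (λ m → f m % 2) (n+p[1+r]≡[n+pr]+p n period r) ⟩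
    f (n + period * r + period) % 2 ≡⟨ periodic (n + period * r) (≤-trans s≤n (m≤m+n n _)) ⟩
    f (n + period * r) % 2          ≡⟨ periodic-* r n s≤n ⟩
    f n % 2                         ∎
    where
    open ≡-Reasoning
    n+p[1+r]≡[n+pr]+p : ∀ n p r → n + p * suc r ≡ n + p * r + p
    n+p[1+r]≡[n+pr]+p = solve-∀

-- p(n,0) = 0 for n ≥ 1.
pA-zero-periodic : ∀ a → ParityEventuallyPeriodic (λ n → pA a n 0)
pA-zero-periodic a = record { period = 1 ; start = 1 ; 1≤period = ≤-refl ; periodic = periodic }
  where
  periodic : ∀ n → 1 ≤ n → pA a (n + 1) 0 % 2 ≡ pA a n 0 % 2
  periodic (suc n) _ = refl

telescope : ∀ (g h : ℕ → ℕ) c → (∀ n → h (n + c) ≡ g (n + c) + h n) →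
            ∀ r n → h (n + c * r) ≡ (∑[ y < r ] g (n + c * suc y)) + h n
telescope g h c step zero    n = cong h (trans (cong (n +_) (*-zeroʳ c)) (+-identityʳ n))
telescope g h c step (suc r) n = begin
  h (n + c * suc r)                              ≡⟨ cong h (n+c[1+r]≡[n+cr]+c n c r) ⟩
  h (n + c * r + c)                              ≡⟨ step (n + c * r) ⟩
  g (n + c * r + c) + h (n + c * r)              ≡⟨ cong₂ _+_ (cong g (sym (n+c[1+r]≡[n+cr]+c n c r)))
                                                              (telescope g h c step r n) ⟩
  g (n + c * suc r) + ((∑[ y < r ] G y) + h n)   ≡⟨ x∙yz≈yx∙z (g (n + c * suc r)) (∑< r G) (h n) ⟩
  (∑[ y < r ] G y) + G r + h n                    ∎
  where
  open ≡-Reasoning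
  G : ℕ → ℕ
  G y = g (n + c * suc y)
  n+c[1+r]≡[n+cr]+c : ∀ n c r → n + c * suc r ≡ n + c * r + c
  n+c[1+r]≡[n+cr]+c = solve-∀

parityEventuallyPeriodic-step : ∀ {g h : ℕ → ℕ} c → 1 ≤ c → (∀ n → h (n + c) ≡ g (n + c) + h n) →
                                ParityEventuallyPeriodic g → ParityEventuallyPeriodic h
parityEventuallyPeriodic-step {g} {h} c 1≤c step P = record
  { period   = c * period + c * period
  ; start    = start
  ; 1≤period = ≤-trans (*-mono-≤ 1≤c 1≤period) (m≤m+n (c * period) (c * period))
  ; periodic = periodic′
  }
  where
  open ParityEventuallyPeriodic P
  S : ℕ → ℕ
  S m = ∑[ y < period ] g (m + c * suc y)
  S-periodic : ∀ n → start ≤ n → S (n + c * period) % 2 ≡ S n % 2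
  S-periodic n s≤n = ∑-%2-cong _ _ period λ y _ →
    trans (cong (λ m → g m % 2) (n+cp+c[1+y]≡n+c[1+y]+pc n c period y))
          (periodic-* c (n + c * suc y) (≤-trans s≤n (m≤m+n n _)))
    where
    n+cp+c[1+y]≡n+c[1+y]+pc : ∀ n c p y → n + c * p + c * suc y ≡ n + c * suc y + p * c
    n+cp+c[1+y]≡n+c[1+y]+pc = solve-∀
  periodic′ : ∀ n → start ≤ n → h (n + (c * period + c * period)) % 2 ≡ h n % 2
  periodic′ n s≤n = begin
    h (n + (c * period + c * period)) % 2           ≡⟨ cong (λ m → h m % 2) (sym (+-assoc n _ _)) ⟩
    h (n + c * period + c * period) % 2             ≡⟨ cong (_% 2) (telescope g h c step period (n + c * period)) ⟩
    (S (n + c * period) + h (n + c * period)) % 2   ≡⟨ cong (λ m → (S (n + c * period) + m) % 2)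
                                                         (telescope g h c step period n) ⟩
    (S (n + c * period) + (S n + h n)) % 2          ≡⟨ [m+[n+o]]%2≡o%2 (S (n + c * period)) (S n) (h n) (S-periodic n s≤n) ⟩
    h n % 2                                         ∎
    where open ≡-Reasoning

pA-parityEventuallyPeriodic : ∀ {a} → AllPositive a → ∀ j → ParityEventuallyPeriodic (λ n → pA a n j)
pA-parityEventuallyPeriodic {a} pos zero    = pA-zero-periodic a
pA-parityEventuallyPeriodic {a} pos (suc j) =
  parityEventuallyPeriodic-step c (pos (suc j) (s≤s z≤n)) step (pA-parityEventuallyPeriodic pos j)
  where
  c : ℕ
  c = a (suc j)
  step : ∀ n → pA a (n + c) (suc j) ≡ pA a (n + c) j + pA a n (suc j)
  step n = trans (pA-rec pos j (n + c)) (cong (pA a (n + c) j +_)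
                 (trans (cong (shift c (λ m → pA a m (suc j))) (+-comm n c)) (shift-+ c (λ m → pA a m (suc j)) n)))

-- Counting by parity

%2≡0⊎1 : ∀ x → x % 2 ≡ 0 ⊎ x % 2 ≡ 1
%2≡0⊎1 x with x % 2 | m%n<n x 2
... | 0           | _               = inj₁ refl
... | 1           | _               = inj₂ refl
... | suc (suc _) | s≤s (s≤s ())

%2≤1 : ∀ x → x % 2 ≤ 1
%2≤1 x = s≤s⁻¹ (m%n<n x 2)

isOdd : ℕ → ℕ
isOdd G = iverson (does (G % 2 ≟ 1))

jointIndicator : ℕ → ℕ → ℕ → ℕ
jointIndicator b H G = iverson (does ((H % 2 ≟ b) ×-dec (G % 2 ≟ 1)))

jointIndicator-total : ∀ H G → jointIndicator 1 H G + jointIndicator 0 H G ≡ isOdd G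
jointIndicator-total H G with %2≡0⊎1 H
... | inj₁ H≡0 rewrite H≡0 = refl
... | inj₂ H≡1 rewrite H≡1 = +-identityʳ (isOdd G)

-- For G odd, G + Y is odd exactly when Y is even; for G even, both sides are Y % 2.
jointIndicator-balance : ∀ {H} G Y → H ≡ G + Y →
                         jointIndicator 1 H G + Y % 2 ≡ jointIndicator 0 H G + H % 2
jointIndicator-balance G Y refl rewrite %-distribˡ-+ G Y 2 {{_}} with %2≡0⊎1 G | %2≡0⊎1 Y
... | inj₁ G≡0 | inj₁ Y≡0 rewrite G≡0 | Y≡0 = refl
... | inj₁ G≡0 | inj₂ Y≡1 rewrite G≡0 | Y≡1 = refl
... | inj₂ G≡1 | inj₁ Y≡0 rewrite G≡1 | Y≡0 = refl
... | inj₂ G≡1 | inj₂ Y≡1 rewrite G≡1 | Y≡1 = refl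

+≡+⇒∣-∣≡∣-∣ : ∀ a b d e → a + d ≡ b + e → ∣ a - b ∣ ≡ ∣ e - d ∣
+≡+⇒∣-∣≡∣-∣ a b d e a+d≡b+e = begin
  ∣ a - b ∣             ≡⟨ ∣m+n-m+o∣≡∣n-o∣ d a b ⟨
  ∣ d + a - d + b ∣     ≡⟨ cong₂ ∣_-_∣ (trans (+-comm d a) a+d≡b+e) (+-comm d b) ⟩
  ∣ b + e - b + d ∣     ≡⟨ ∣m+n-m+o∣≡∣n-o∣ b e d ⟩
  ∣ e - d ∣             ∎
  where open ≡-Reasoning

∑-extend-∣-∣ : ∀ (f : ℕ → ℕ) → (∀ i → f i ≤ 1) → ∀ t c → ∣ ∑[ i < t + c ] f i - ∑[ i < t ] f i ∣ ≤ c
∑-extend-∣-∣ f f≤1 t c = begin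
  ∣ ∑[ i < t + c ] f i - ∑[ i < t ] f i ∣                                ≡⟨ cong (∣_- ∑< t f ∣) (∑-split f t c) ⟩
  ∣ (∑[ i < t ] f i) + (∑[ i < c ] f (t + i)) - ∑[ i < t ] f i ∣         ≡⟨ ∣-∣-comm _ (∑< t f) ⟩
  ∣ ∑[ i < t ] f i - (∑[ i < t ] f i) + (∑[ i < c ] f (t + i)) ∣         ≡⟨ ∣m-m+n∣≡n (∑< t f) _ ⟩
  ∑[ i < c ] f (t + i)                                                   ≤⟨ ∑-≤ (λ i → f (t + i)) (λ i → f≤1 (t + i)) c ⟩
  c                                                                      ∎
  where open ≤-Reasoning

jointCount : ℕ → (ℕ → ℕ) → (ℕ → ℕ) → ℕ → ℕ
jointCount b h g t = ∑[ n < t ] jointIndicator b (h n) (g n)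

oddCount : (ℕ → ℕ) → ℕ → ℕ
oddCount g t = ∑[ n < t ] isOdd (g n)

jointCount-total : ∀ h g t → jointCount 1 h g t + jointCount 0 h g t ≡ oddCount g t
jointCount-total h g t = trans (sym (∑-+ _ _ t)) (∑-cong t λ n _ → jointIndicator-total (h n) (g n))

∑-shift-%2 : ∀ c h t → ∑[ n < c + t ] (shift c h n % 2) ≡ ∑[ i < t ] (h i % 2)
∑-shift-%2 c h t = begin
  ∑[ n < c + t ] (shift c h n % 2)                                       ≡⟨ ∑-split _ c t ⟩
  (∑[ n < c ] (shift c h n % 2)) + (∑[ i < t ] (shift c h (c + i) % 2))  ≡⟨ cong₂ _+_
      (trans (∑-cong c λ n n<c → cong (_% 2) (shift-< h n<c)) (∑-zero c))
      (∑-cong t λ i _ → cong (_% 2) (shift-+ c h i)) ⟩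
  ∑[ i < t ] (h i % 2)                                                   ∎
  where open ≡-Reasoning

jointCount-∣-∣≤ : ∀ {g h : ℕ → ℕ} c → (∀ n → h n ≡ g n + shift c h n) →
                 ∀ t → ∣ jointCount 1 h g t - jointCount 0 h g t ∣ ≤ c
jointCount-∣-∣≤ {g} {h} c rec t = begin
  ∣ jointCount 1 h g t - jointCount 0 h g t ∣ ≡⟨ +≡+⇒∣-∣≡∣-∣ _ _ (Y t) (Y (t + c)) balance ⟩
  ∣ Y (t + c) - Y t ∣                         ≤⟨ ∑-extend-∣-∣ (λ n → shift c h n % 2) (λ n → %2≤1 (shift c h n)) t c ⟩
  c                                           ∎
  where
  open ≤-Reasoning
  Y : ℕ → ℕ
  Y r = ∑[ n < r ] (shift c h n % 2)
  balance : jointCount 1 h g t + Y t ≡ jointCount 0 h g t + Y (t + c)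
  balance = begin-equality
    jointCount 1 h g t + Y t                   ≡⟨ ∑-+ _ _ t ⟨
    ∑[ n < t ] (jointIndicator 1 (h n) (g n) + shift c h n % 2)
      ≡⟨ ∑-cong t (λ n _ → jointIndicator-balance (g n) (shift c h n) (rec n)) ⟩
    ∑[ n < t ] (jointIndicator 0 (h n) (g n) + h n % 2)
      ≡⟨ ∑-+ _ _ t ⟩
    jointCount 0 h g t + (∑[ n < t ] (h n % 2)) ≡⟨ cong (jointCount 0 h g t +_) (sym (∑-shift-%2 c h t)) ⟩
    jointCount 0 h g t + Y (c + t)             ≡⟨ cong (λ s → jointCount 0 h g t + Y s) (+-comm c t) ⟩
    jointCount 0 h g t + Y (t + c)             ∎

-- Densities

record BoundedDiscrepancy (Q C B : ℕ) (s : ℕ → ℕ) : Set where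
  constructor boundedDiscrepancy
  field ∣Q*s-C*t∣≤B : ∀ t → ∣ Q * s t - C * t ∣ ≤ B

open BoundedDiscrepancy

∑-periodic : ∀ (u : ℕ → ℕ) Q T → (∀ n → T ≤ n → u (n + Q) ≡ u n) →
             ∀ t → T ≤ t → ∑[ n < t + Q ] u n ≡ (∑[ n < t ] u n) + (∑[ i < Q ] u (T + i))
∑-periodic u Q T periodic t T≤t with m≤n⇒∃[o]m+o≡n T≤t
... | d , refl = go d
  where
  C : ℕ
  C = ∑[ i < Q ] u (T + i)
  go : ∀ d → ∑[ n < T + d + Q ] u n ≡ (∑[ n < T + d ] u n) + C
  go zero    = trans (cong (λ s → ∑< (s + Q) u) (+-identityʳ T))
                     (trans (∑-split u T Q) (cong (_+ C) (cong (λ s → ∑< s u) (sym (+-identityʳ T)))))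
  go (suc d) = begin
    ∑[ n < T + suc d + Q ] u n                    ≡⟨ cong (λ s → ∑< s u) (cong (_+ Q) (+-suc T d)) ⟩
    (∑[ n < T + d + Q ] u n) + u (T + d + Q)      ≡⟨ cong₂ _+_ (go d) (periodic (T + d) (m≤m+n T d)) ⟩
    (∑[ n < T + d ] u n) + C + u (T + d)          ≡⟨ xy∙z≈xz∙y (∑< (T + d) u) C (u (T + d)) ⟩
    (∑[ n < T + d ] u n) + u (T + d) + C          ≡⟨ cong (λ s → ∑< s u + C) (sym (+-suc T d)) ⟩
    (∑[ n < T + suc d ] u n) + C                  ∎
    where open ≡-Reasoning

boundedDiscrepancy-of-increments : ∀ (U : ℕ → ℕ) Q C T → 1 ≤ Q → C ≤ Q → (∀ t → U t ≤ t) →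
                                   (∀ t → T ≤ t → U (t + Q) ≡ U t + C) → BoundedDiscrepancy Q C (Q * (T + Q)) U
boundedDiscrepancy-of-increments U Q C T 1≤Q C≤Q U≤id increment = boundedDiscrepancy (<-rec _ go)
  where
  B : ℕ
  B = Q * (T + Q)
  go : ∀ t → (∀ {t′} → t′ < t → ∣ Q * U t′ - C * t′ ∣ ≤ B) → ∣ Q * U t - C * t ∣ ≤ B
  go t rec with t <? T + Q
  ... | yes t<T+Q = ≤-trans (∣m-n∣≤m⊔n (Q * U t) (C * t))
                            (⊔-lub (≤-trans (*-monoʳ-≤ Q (U≤id t)) Qt≤B) (≤-trans (*-monoˡ-≤ t C≤Q) Qt≤B))
    where
    Qt≤B : Q * t ≤ B
    Qt≤B = *-monoʳ-≤ Q (<⇒≤ t<T+Q)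
  ... | no t≮T+Q = begin
    ∣ Q * U t - C * t ∣                         ≡⟨ cong (λ s → ∣ Q * U s - C * s ∣) t′+Q≡t ⟨
    ∣ Q * U (t′ + Q) - C * (t′ + Q) ∣           ≡⟨ cong₂ ∣_-_∣ (trans (cong (Q *_) (increment t′ T≤t′))
                                                                     (*-distribˡ-+ Q (U t′) C))
                                                              (trans (*-distribˡ-+ C t′ Q) (cong (C * t′ +_) (*-comm C Q))) ⟩
    ∣ Q * U t′ + Q * C - C * t′ + Q * C ∣       ≡⟨ cong₂ ∣_-_∣ (+-comm (Q * U t′) (Q * C)) (+-comm (C * t′) (Q * C)) ⟩
    ∣ Q * C + Q * U t′ - Q * C + C * t′ ∣       ≡⟨ ∣m+n-m+o∣≡∣n-o∣ (Q * C) (Q * U t′) (C * t′) ⟩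
    ∣ Q * U t′ - C * t′ ∣                       ≤⟨ rec t′<t ⟩
    B                                           ∎
    where
    open ≤-Reasoning
    T+Q≤t : T + Q ≤ t
    T+Q≤t = ≮⇒≥ t≮T+Q
    t′ : ℕ
    t′ = t ∸ Q
    t′+Q≡t : t′ + Q ≡ t
    t′+Q≡t = m∸n+n≡m (≤-trans (m≤n+m Q T) T+Q≤t)
    T≤t′ : T ≤ t′
    T≤t′ = m+n≤o⇒m≤o∸n T T+Q≤t
    t′<t : t′ < t
    t′<t = subst (t′ <_) t′+Q≡t (m<m+n t′ 1≤Q)

boundedDiscrepancy-half : ∀ {Q C B c} (x y u : ℕ → ℕ) → (∀ t → x t + y t ≡ u t) → (∀ t → ∣ x t - y t ∣ ≤ c) →
                          BoundedDiscrepancy Q C B u → BoundedDiscrepancy (2 * Q) C (Q * c + B) x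
boundedDiscrepancy-half {Q} {C} {B} {c} x y u x+y≡u ∣x-y∣≤c disc = boundedDiscrepancy λ t → begin
  ∣ 2 * Q * x t - C * t ∣                         ≤⟨ ∣-∣-triangle (2 * Q * x t) (Q * u t) (C * t) ⟩
  ∣ 2 * Q * x t - Q * u t ∣ + ∣ Q * u t - C * t ∣ ≡⟨ cong (_+ ∣ Q * u t - C * t ∣) (begin-equality
      ∣ 2 * Q * x t - Q * u t ∣                      ≡⟨ cong₂ ∣_-_∣ (2Qx≡Q[x+x] Q (x t)) (cong (Q *_) (sym (x+y≡u t))) ⟩
      ∣ Q * (x t + x t) - Q * (x t + y t) ∣         ≡⟨ *-distribˡ-∣-∣ Q (x t + x t) (x t + y t) ⟨
      Q * ∣ x t + x t - x t + y t ∣                  ≡⟨ cong (Q *_) (∣m+n-m+o∣≡∣n-o∣ (x t) (x t) (y t)) ⟩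
      Q * ∣ x t - y t ∣                              ∎) ⟩
  Q * ∣ x t - y t ∣ + ∣ Q * u t - C * t ∣         ≤⟨ +-mono-≤ (*-monoʳ-≤ Q (∣x-y∣≤c t)) (∣Q*s-C*t∣≤B disc t) ⟩
  Q * c + B                                       ∎
  where
  open ≤-Reasoning
  2Qx≡Q[x+x] : ∀ Q x → 2 * Q * x ≡ Q * (x + x)
  2Qx≡Q[x+x] = solve-∀

boundedDiscrepancy-suc : ∀ {Q C B} s → BoundedDiscrepancy Q C B s → BoundedDiscrepancy Q C (B + C) (λ N → s (suc N))
boundedDiscrepancy-suc {Q} {C} {B} s disc = boundedDiscrepancy λ N → begin
  ∣ Q * s (suc N) - C * N ∣                                    ≤⟨ ∣-∣-triangle (Q * s (suc N)) (C * suc N) (C * N) ⟩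
  ∣ Q * s (suc N) - C * suc N ∣ + ∣ C * suc N - C * N ∣
    ≡⟨ cong (λ z → ∣ Q * s (suc N) - C * suc N ∣ + z) (∣C[1+N]-CN∣≡C N) ⟩
  ∣ Q * s (suc N) - C * suc N ∣ + C                            ≤⟨ +-monoˡ-≤ C (∣Q*s-C*t∣≤B disc (suc N)) ⟩
  B + C                                                        ∎
  where
  open ≤-Reasoning
  ∣C[1+N]-CN∣≡C : ∀ N → ∣ C * suc N - C * N ∣ ≡ C
  ∣C[1+N]-CN∣≡C N = trans (∣-∣-comm (C * suc N) (C * N))
                        (trans (cong (∣ C * N -_∣) (trans (*-suc C N) (+-comm C (C * N)))) (∣m-m+n∣≡n (C * N) C))

boundedDiscrepancy-cong : ∀ {Q C B s s′} → (∀ t → s t ≡ s′ t) → BoundedDiscrepancy Q C B s → BoundedDiscrepancy Q C B s′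
boundedDiscrepancy-cong {Q} {C} {B} s≗s′ disc =
  boundedDiscrepancy λ t → subst (λ z → ∣ Q * z - C * t ∣ ≤ B) (s≗s′ t) (∣Q*s-C*t∣≤B disc t)

oddCount-boundedDiscrepancy : ∀ {g} (P : ParityEventuallyPeriodic g) → let open ParityEventuallyPeriodic P in
  BoundedDiscrepancy period (∑[ i < period ] isOdd (g (start + i))) (period * (start + period)) (oddCount g)
oddCount-boundedDiscrepancy {g} P =
  boundedDiscrepancy-of-increments (oddCount g) period _ start 1≤period
    (∑-≤ _ (λ i → iverson≤1 _) period) (∑-≤ _ (λ n → iverson≤1 _))
    (∑-periodic (λ n → isOdd (g n)) period start λ n s≤n → cong (λ r → iverson (does (r ≟ 1))) (periodic n s≤n))
  where open ParityEventuallyPeriodic P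

count≡jointCount : ∀ a k b N → count a k b N ≡ jointCount b (λ n → pA a n k) (λ n → pA a n (k ∸ 1)) (suc N)
count≡jointCount a k b N = trans (length-filter≡sumBy _ (upTo (suc N))) (sumBy-upTo _ (suc N))

count-boundedDiscrepancy : ∀ {a} → AllPositive a → ∀ j → ∃[ Q ] ∃[ C ] ∃[ B ] 1 ≤ Q ×
  BoundedDiscrepancy Q C B (count a (suc j) 1) × BoundedDiscrepancy Q C B (count a (suc j) 0)
count-boundedDiscrepancy {a} pos j = 2 * period , C , B + C , *-mono-≤ {1} {2} (s≤s z≤n) 1≤period ,
  boundedDiscrepancy-count 1 0 (jointCount-total h g) ∣J₁-J₀∣≤c ,
  boundedDiscrepancy-count 0 1 (λ t → trans (+-comm (joint 0 t) (joint 1 t)) (jointCount-total h g t))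
                               (λ t → subst (_≤ c) (∣-∣-comm (joint 1 t) (joint 0 t)) (∣J₁-J₀∣≤c t))
  where
  g h : ℕ → ℕ
  g n = pA a n j
  h n = pA a n (suc j)
  c : ℕ
  c = a (suc j)
  open ParityEventuallyPeriodic (pA-parityEventuallyPeriodic pos j)
  C B : ℕ
  C = ∑[ i < period ] isOdd (g (start + i))
  B = period * c + period * (start + period)
  joint : ℕ → ℕ → ℕ
  joint b = jointCount b h g
  ∣J₁-J₀∣≤c : ∀ t → ∣ joint 1 t - joint 0 t ∣ ≤ c
  ∣J₁-J₀∣≤c = jointCount-∣-∣≤ c (pA-rec pos j)
  boundedDiscrepancy-count : ∀ b b′ → (∀ t → joint b t + joint b′ t ≡ oddCount g t) →
                             (∀ t → ∣ joint b t - joint b′ t ∣ ≤ c) →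
                             BoundedDiscrepancy (2 * period) C (B + C) (count a (suc j) b)
  boundedDiscrepancy-count b b′ total ∣Jb-Jb′∣≤c =
    boundedDiscrepancy-cong (λ N → sym (count≡jointCount a (suc j) b N))
      (boundedDiscrepancy-suc (joint b)
        (boundedDiscrepancy-half (joint b) (joint b′) (oddCount g) total ∣Jb-Jb′∣≤c
          (oddCount-boundedDiscrepancy (pA-parityEventuallyPeriodic pos j))))

-- Limits of averages

∣⊖∣≡∣-∣ : ∀ m n → ℤ.∣ m ℤ.⊖ n ∣ ≡ ∣ m - n ∣
∣⊖∣≡∣-∣ m n with ≤-total m n
... | inj₁ m≤n = trans (ℤ.∣⊖∣-≤ m≤n) (sym (m≤n⇒∣m-n∣≡n∸m m≤n))
... | inj₂ n≤m = trans (ℤ.∣m⊖n∣≡∣n⊖m∣ m n) (trans (ℤ.∣⊖∣-≤ n≤m) (sym (m≤n⇒∣n-m∣≡n∸m n≤m)))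

cross-difference-scaled-≤ : ∀ {Q C B} x y N N′ → ∣ Q * x - C * N ∣ ≤ B → ∣ Q * y - C * N′ ∣ ≤ B →
                   Q * ∣ x * N′ - y * N ∣ ≤ B * N′ + B * N
cross-difference-scaled-≤ {Q} {C} {B} x y N N′ ∣Qx-CN∣≤B ∣Qy-CN′∣≤B = begin
  Q * ∣ x * N′ - y * N ∣                               ≡⟨ *-distribˡ-∣-∣ Q (x * N′) (y * N) ⟩
  ∣ Q * (x * N′) - Q * (y * N) ∣                       ≡⟨ cong₂ ∣_-_∣ (sym (*-assoc Q x N′)) (sym (*-assoc Q y N)) ⟩
  ∣ Q * x * N′ - Q * y * N ∣                           ≤⟨ ∣-∣-triangle (Q * x * N′) (C * N * N′) (Q * y * N) ⟩
  ∣ Q * x * N′ - C * N * N′ ∣ + ∣ C * N * N′ - Q * y * N ∣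
    ≡⟨ cong₂ _+_ (sym (*-distribʳ-∣-∣ N′ (Q * x) (C * N)))
                 (trans (cong (∣_- Q * y * N ∣) (*-CS.xy∙z≈xz∙y C N N′)) (sym (*-distribʳ-∣-∣ N (C * N′) (Q * y)))) ⟩
  ∣ Q * x - C * N ∣ * N′ + ∣ C * N′ - Q * y ∣ * N
    ≤⟨ +-mono-≤ (*-monoˡ-≤ N′ ∣Qx-CN∣≤B) (*-monoˡ-≤ N (subst (_≤ B) (∣-∣-comm (Q * y) (C * N′)) ∣Qy-CN′∣≤B)) ⟩
  B * N′ + B * N                                       ∎
  where open ≤-Reasoning

cross-difference-small : ∀ {Q B} D N N′ p q → 1 ≤ Q → Q * D ≤ B * N′ + B * N →
                  2 * (B * suc q) < N → 2 * (B * suc q) < N′ → D * suc q < suc p * (N * N′)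
cross-difference-small {Q} {B} D N N′ p q 1≤Q QD≤BN′+BN 2L<N 2L<N′ = begin-strict
  D * suc q                    ≤⟨ *-monoˡ-≤ (suc q) (≤-trans (m≤n*m D Q {{>-nonZero 1≤Q}}) QD≤BN′+BN) ⟩
  (B * N′ + B * N) * suc q     ≡⟨ distrib B N′ N (suc q) ⟩
  L * N′ + L * N               <⟨ *-cancelˡ-< 2 (L * N′ + L * N) (N * N′) twice ⟩
  N * N′                       ≤⟨ m≤n*m (N * N′) (suc p) ⟩
  suc p * (N * N′)             ∎
  where
  open ≤-Reasoning
  L : ℕ
  L = B * suc q
  distrib : ∀ B N′ N s → (B * N′ + B * N) * s ≡ B * s * N′ + B * s * N
  distrib = solve-∀
  double : ∀ L N N′ → 2 * (L * N′ + L * N) ≡ 2 * L * N′ + 2 * L * N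
  double = solve-∀
  double′ : ∀ N N′ → N * N′ + N′ * N ≡ 2 * (N * N′)
  double′ = solve-∀
  twice : 2 * (L * N′ + L * N) < 2 * (N * N′)
  twice = begin-strict
    2 * (L * N′ + L * N)       ≡⟨ double L N N′ ⟩
    2 * L * N′ + 2 * L * N     <⟨ +-mono-< (*-monoˡ-< N′ {{>-nonZero (≤-trans (s≤s z≤n) 2L<N′)}} 2L<N)
                                           (*-monoˡ-< N {{>-nonZero (≤-trans (s≤s z≤n) 2L<N)}} 2L<N′) ⟩
    N * N′ + N′ * N            ≡⟨ double′ N N′ ⟩
    2 * (N * N′)               ∎

toℚᵘ-∣/-/∣ : ∀ x y m m′ → toℚᵘ (ℚ.∣ ℤ.+ x / suc m ℚ.- ℤ.+ y / suc m′ ∣)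
                          ℚᵘ.≃ ℚᵘ.∣ ℚᵘ.mkℚᵘ (ℤ.+ x) m ℚᵘ.- ℚᵘ.mkℚᵘ (ℤ.+ y) m′ ∣
toℚᵘ-∣/-/∣ x y m m′ = ℚᵘ.≃-trans (ℚ.toℚᵘ-homo-∣-∣ (ℤ.+ x / suc m ℚ.- ℤ.+ y / suc m′)) (ℚᵘ.∣-∣-cong
  (ℚᵘ.≃-trans (ℚ.toℚᵘ-homo-+ (ℤ.+ x / suc m) (ℚ.- (ℤ.+ y / suc m′)))
    (ℚᵘ.+-cong (ℚ.toℚᵘ-fromℚᵘ (ℚᵘ.mkℚᵘ (ℤ.+ x) m))
               (ℚᵘ.≃-trans (ℚ.toℚᵘ-homo‿- (ℤ.+ y / suc m′))
                           (ℚᵘ.-‿cong (ℚ.toℚᵘ-fromℚᵘ (ℚᵘ.mkℚᵘ (ℤ.+ y) m′)))))))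

∣/-/∣< : ∀ x y m m′ p q .{coprime : Coprime (suc p) (suc q)} →
         ∣ x * suc m′ - y * suc m ∣ * suc q < suc p * (suc m * suc m′) →
         ℚ.∣ ℤ.+ x / suc m ℚ.- ℤ.+ y / suc m′ ∣ ℚ.< mkℚ ℤ.+[1+ p ] q coprime
∣/-/∣< x y m m′ p q D[1+q]<[1+p]NN′ =
  ℚ.toℚᵘ-cancel-< (ℚᵘ.<-respˡ-≃ (ℚᵘ.≃-sym (toℚᵘ-∣/-/∣ x y m m′))
                    (ℚᵘ.*<* (subst₂ ℤ._<_ numerator denominator (ℤ.+<+ D[1+q]<[1+p]NN′))))
  where
  difference : ℤ.+ x ℤ.* ℤ.+ suc m′ ℤ.+ ℤ.- (ℤ.+ y) ℤ.* ℤ.+ suc m ≡ (x * suc m′) ℤ.⊖ (y * suc m)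
  difference = trans (cong₂ ℤ._+_ (sym (ℤ.pos-* x (suc m′)))
                                 (trans (sym (ℤ.neg-distribˡ-* (ℤ.+ y) (ℤ.+ suc m))) (cong ℤ.-_ (sym (ℤ.pos-* y (suc m))))))
                     (ℤ.m-n≡m⊖n (x * suc m′) (y * suc m))
  numerator : ℤ.+ (∣ x * suc m′ - y * suc m ∣ * suc q)
            ≡ ℤ.+ ℤ.∣ ℤ.+ x ℤ.* ℤ.+ suc m′ ℤ.+ ℤ.- (ℤ.+ y) ℤ.* ℤ.+ suc m ∣ ℤ.* ℤ.+ suc q
  numerator = trans (ℤ.pos-* ∣ x * suc m′ - y * suc m ∣ (suc q))
                    (cong (λ z → ℤ.+ z ℤ.* ℤ.+ suc q) (trans (sym (∣⊖∣≡∣-∣ (x * suc m′) (y * suc m)))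
                                                         (cong ℤ.∣_∣ (sym difference))))
  denominator : ℤ.+ (suc p * (suc m * suc m′)) ≡ ℤ.+[1+ p ] ℤ.* ℤ.+ (suc m * suc m′)
  denominator = ℤ.pos-* (suc p) _

ratio-cauchy : ∀ {Q C B} (s s′ : ℕ → ℕ) → 1 ≤ Q → BoundedDiscrepancy Q C B s → BoundedDiscrepancy Q C B s′ →
               ∀ ε → 0ℚ ℚ.< ε → ∃[ M ] ∀ m m′ → M ≤ m → M ≤ m′ →
                 ℚ.∣ ℤ.+ s (suc m) / suc m ℚ.- ℤ.+ s′ (suc m′) / suc m′ ∣ ℚ.< ε
ratio-cauchy {Q} {C} {B} s s′ 1≤Q disc disc′ (mkℚ ℤ.+[1+ p ] q _) _ = 2 * (B * suc q) , λ m m′ M≤m M≤m′ →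
  let x = s (suc m) ; y = s′ (suc m′) in
  ∣/-/∣< x y m m′ p q
    (cross-difference-small {Q} {B} ∣ x * suc m′ - y * suc m ∣ (suc m) (suc m′) p q 1≤Q
       (cross-difference-scaled-≤ {Q} {C} {B} x y (suc m) (suc m′)
         (∣Q*s-C*t∣≤B disc (suc m)) (∣Q*s-C*t∣≤B disc′ (suc m′)))
       (s≤s M≤m) (s≤s M≤m′))
ratio-cauchy s s′ 1≤Q disc disc′ (mkℚ ℤ.+0 _ _) 0<ε with () ← ℚ.positive 0<ε
ratio-cauchy s s′ 1≤Q disc disc′ (mkℚ ℤ.-[1+ _ ] _ _) 0<ε with () ← ℚ.positive 0<ε

sameLimit-of-boundedDiscrepancy : ∀ {Q C B} (s s′ : ℕ → ℕ) → 1 ≤ Q →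
                                  BoundedDiscrepancy Q C B s → BoundedDiscrepancy Q C B s′ →
                                  SameLimit (λ m → ℤ.+ s (suc m) / suc m) (λ m → ℤ.+ s′ (suc m) / suc m)
sameLimit-of-boundedDiscrepancy s s′ 1≤Q disc disc′ =
  ratio-cauchy s s 1≤Q disc disc , ratio-cauchy s′ s′ 1≤Q disc′ disc′ ,
  λ ε 0<ε → let M , close = ratio-cauchy s s′ 1≤Q disc disc′ ε 0<ε in M , λ m M≤m → close m m M≤m M≤m

lemma4p1 : (a : ℕ → ℕ) → (∀ i → 1 ≤ i → 0 < a i) →
           (k : ℕ) → 2 ≤ k →
           SameLimit (ratio a k 1) (ratio a k 0)
lemma4p1 a pos k@(suc (suc j)) (s≤s (s≤s z≤n)) =
  let Q , C , B , 1≤Q , disc₁ , disc₀ = count-boundedDiscrepancy pos (suc j) in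
  sameLimit-of-boundedDiscrepancy (count a k 1) (count a k 0) 1≤Q disc₁ disc₀
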